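{- Let $G$ be a finite simple graph without isolated vertices on the vertex set $[n]$, and let $H$ be a subgraph of $G$ (without isolated vertices) with vertex set $U\subseteq[n]$. Then $\mathcal{P}(H)$ is a face of $\mathcal{P}(G)$ if and only if $\mathcal{P}(H)$ is a face of $\mathcal{P}(G[U])$.
   Context: All graphs are finite, undirected, without loops, multiple edges or isolated vertices. For a graph $G$ on vertex set $[n]$, the edge polytope is $\mathcal{P}(G)=\mathrm{conv}\{e_i+e_j : \{i,j\}\in E(G)\}\subseteq\mathbb{R}^n$, where $e_i$ is the $i$th unit vector; for subgraphs $H$ of $G$ (and induced subgraphs $G[U]$), $\mathcal{P}(H)$ is formed in the same ambient space $\mathbb{R}^n$ from the edges of $H$. $G[U]$ is the subgraph of $G$ induced by $U$.
   Formalization: The edge polytopes are taken in ℚ^n rather than ℝ^n: points have rational coordinates, convex combinations have rational weights, and faces are cut out by supporting hyperplanes with rational coefficients. -}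

module Defs where

open import Data.Nat using (ℕ; zero; suc; _<_)
open import Data.Fin using (Fin; zero; suc; toℕ; _≟_)
open import Data.Product using (_×_; _,_; proj₁; proj₂; ∃; Σ)
open import Data.Sum using (_⊎_)
open import Data.List using (List; []; _∷_; length; zipWith; filter)
open import Data.List.Relation.Unary.All using (All)
open import Data.List.Relation.Unary.Any using (Any; any?)
open import Data.List.Relation.Unary.Unique.Propositional using (Unique)
open import Data.List.Membership.Propositional using (_∈_)
open import Data.Rational using (ℚ; 0ℚ; 1ℚ; _+_; _*_; _≤_)
open import Relation.Binary.PropositionalEquality using (_≡_)
open import Relation.Nullary using (Dec; yes; no)
open import Relation.Nullary.Decidable using (_⊎-dec_; _×-dec_)
open import Function.Bundles using (_⇔_)

-- Points of the ambient space ℚ^n (rational points of ℝ^n)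
Pt : ℕ → Set
Pt n = Fin n → ℚ

sumℚ : List ℚ → ℚ
sumℚ [] = 0ℚ
sumℚ (x ∷ xs) = x + sumℚ xs

sumFin : (n : ℕ) → (Fin n → ℚ) → ℚ
sumFin zero f = 0ℚ
sumFin (suc n) f = f zero + sumFin n (λ i → f (suc i))

dot : {n : ℕ} → Pt n → Pt n → ℚ
dot {n} a x = sumFin n (λ k → a k * x k)

InConv : {n : ℕ} → List (Pt n) → Pt n → Set
InConv {n} vs x =
  Σ (List ℚ) λ w →
    (length w ≡ length vs) × All (0ℚ ≤_) w × (sumℚ w ≡ 1ℚ) ×
    (∀ k → x k ≡ sumℚ (zipWith (λ c v → c * v k) w vs))

IsFace : {n : ℕ} → (Pt n → Set) → (Pt n → Set) → Set
IsFace {n} F P =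
  Σ (Pt n) λ a → Σ ℚ λ b →
    (∀ x → P x → dot a x ≤ b) ×
    (∀ x → F x ⇔ (P x × dot a x ≡ b))

-- Graphs on vertex set [n] = Fin n; an edge {i,j} is stored as (i , j) with i < j
Edge : ℕ → Set
Edge n = Fin n × Fin n

record Graph (n : ℕ) : Set where
  field
    edges   : List (Edge n)
    ordered : All (λ e → toℕ (proj₁ e) < toℕ (proj₂ e)) edges
    unique  : Unique edges
open Graph public

Incident : {n : ℕ} → Fin n → Edge n → Set
Incident v e = (v ≡ proj₁ e) ⊎ (v ≡ proj₂ e)

incident? : {n : ℕ} → (v : Fin n) → (e : Edge n) → Dec (Incident v e)
incident? v e = (v ≟ proj₁ e) ⊎-dec (v ≟ proj₂ e)

-- v is a vertex of (the edge set of) G, i.e. not isolated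
InV : {n : ℕ} → Graph n → Fin n → Set
InV G v = Any (Incident v) (edges G)

inV? : {n : ℕ} → (G : Graph n) → (v : Fin n) → Dec (InV G v)
inV? G v = any? (incident? v) (edges G)

NoIsolated : {n : ℕ} → Graph n → Set
NoIsolated {n} G = (v : Fin n) → InV G v

Subgraph : {n : ℕ} → Graph n → Graph n → Set
Subgraph H G = ∀ e → e ∈ edges H → e ∈ edges G

-- edges of G[U] where U = V(H) is the vertex set of H
inducedEdges : {n : ℕ} → Graph n → Graph n → List (Edge n)
inducedEdges G H = filter (λ e → inV? H (proj₁ e) ×-dec inV? H (proj₂ e)) (edges G)

unitVec : {n : ℕ} → Fin n → Pt n
unitVec i k with k ≟ i
... | yes _ = 1ℚ
... | no _  = 0ℚ

edgeVec : {n : ℕ} → Edge n → Pt n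
edgeVec e k = unitVec (proj₁ e) k + unitVec (proj₂ e) k

EdgePolytopeL : {n : ℕ} → List (Edge n) → Pt n → Set
EdgePolytopeL es = InConv (Data.List.map edgeVec es)

EdgePolytope : {n : ℕ} → Graph n → Pt n → Set
EdgePolytope G = EdgePolytopeL (edges G)

InducedEdgePolytope : {n : ℕ} → Graph n → Graph n → Pt n → Set
InducedEdgePolytope G H = EdgePolytopeL (inducedEdges G H)

-- Since P(H) ⊆ P(G[U]) ⊆ P(G), a supporting hyperplane of P(G) cutting out P(H) also cuts it
-- out of P(G[U]). Conversely, let a·x ≤ b cut P(H) out of P(G[U]). Lowering the coefficients
-- of the vertices outside U = V(H) far enough keeps the inequality unchanged on the vertices e_i + e_j
-- of G[U] and makes it strict on every other edge vector of G. The new inequality is then valid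
-- on P(G), and a point of P(G) attaining equality is a convex combination of tight vertices
-- only, hence lies in P(G[U]) and so, being tight there, in P(H).
module Submission where

open import Defs
open import Data.Nat using (ℕ; zero; suc)
open import Data.Nat.Properties using (suc-injective)
open import Data.Fin using (Fin; zero; suc; _≟_)
open import Data.Product using (_×_; _,_; proj₁; proj₂; Σ)
open import Data.Sum using (_⊎_; inj₁; inj₂)
open import Data.Empty using (⊥-elim)
open import Data.List using (List; []; _∷_; length; map; zipWith)
open import Data.List.Relation.Unary.All as All using (All; []; _∷_)
import Data.List.Relation.Unary.Any as Any
open import Data.List.Relation.Unary.Any using (here)
open import Data.List.Relation.Binary.Pointwise using (Pointwise; []; _∷_)
open import Data.List.Relation.Binary.Subset.Propositional using (_⊆_)
open import Data.List.Relation.Binary.Subset.Propositional.Properties using (map⁺; filter-⊆)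
open import Data.List.Membership.Propositional using (_∈_)
open import Data.List.Membership.Propositional.Properties
  using (∈-map⁻; ∈-filter⁺; ∈-map∘filter⁺; ∈-map∘filter⁻)
open import Data.Rational using (ℚ; 0ℚ; 1ℚ; _+_; _*_; _-_; -_; _≤_; _<_; _⊔_; _⊓_; nonNegative; positive)
open import Data.Rational.Properties
  using ( +-identityˡ; +-identityʳ; *-identityˡ; *-identityʳ; *-zeroˡ; *-zeroʳ; +-comm
        ; ≤-refl; ≤-reflexive; ≤-trans; ≤-antisym; <⇒≤; <⇒≢; ≮⇒≥; <-cmp; <-irrefl; <-≤-trans; <-respˡ-≡
        ; +-mono-≤; +-monoˡ-≤; +-monoʳ-≤; +-monoʳ-<; +-mono-<-≤; +-mono-≤-<
        ; *-monoˡ-≤-nonNeg; *-cancelˡ-≤-pos; nonNegative⁻¹; negative⁻¹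
        ; p≤p⊔q; p≤q⊔p; p⊓q≤p; p⊓q≤q; module ≤-Reasoning )
open import Data.Rational.Solver using (module +-*-Solver)
open import Relation.Binary.PropositionalEquality using (_≡_; refl; sym; trans; cong; cong₂)
open import Relation.Binary.Definitions using (tri<; tri≈; tri>)
open import Relation.Nullary using (¬_; Dec; yes; no)
open import Relation.Nullary.Decidable using (_×-dec_)
open import Function using (_∘_)
open import Function.Bundles using (_⇔_; mk⇔; Equivalence)

open +-*-Solver using (solve; con; _:+_; _:-_; :-_; _:*_; _:=_)
open Equivalence using (to; from)

private
  variable
    n : ℕ

+-≤-tight : ∀ {x y s t : ℚ} → x ≤ y → s ≤ t → x + s ≡ y + t → x ≡ y × s ≡ t
+-≤-tight x≤y s≤t eq =
  ≤-antisym x≤y (≮⇒≥ λ x<y → <⇒≢ (+-mono-<-≤ x<y s≤t) eq) ,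
  ≤-antisym s≤t (≮⇒≥ λ s<t → <⇒≢ (+-mono-≤-< x≤y s<t) eq)

*-≤-tight : ∀ {c x y : ℚ} → 0ℚ ≤ c → x ≤ y → c * x ≡ c * y → c ≡ 0ℚ ⊎ x ≡ y
*-≤-tight {c} 0≤c x≤y eq with <-cmp 0ℚ c
... | tri< 0<c _ _ = inj₂ (≤-antisym x≤y (*-cancelˡ-≤-pos c {{positive 0<c}} (≤-reflexive (sym eq))))
... | tri≈ _ 0≡c _ = inj₁ (sym 0≡c)
... | tri> _ _ c<0 = ⊥-elim (<-irrefl refl (<-≤-trans c<0 0≤c))

upperBound : (f : Fin n → ℚ) → Σ ℚ λ T → ∀ i → f i ≤ T
upperBound {zero} f = 0ℚ , λ ()
upperBound {suc n} f with upperBound (f ∘ suc)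
... | T , f∘suc≤T = f zero ⊔ T , λ where
  zero → p≤p⊔q (f zero) T
  (suc i) → ≤-trans (f∘suc≤T i) (p≤q⊔p (f zero) T)

dot-congʳ : (a : Pt n) {x y : Pt n} → (∀ k → x k ≡ y k) → dot a x ≡ dot a y
dot-congʳ {zero} a x≗y = refl
dot-congʳ {suc n} a x≗y = cong₂ _+_ (cong (a zero *_) (x≗y zero)) (dot-congʳ (a ∘ suc) (x≗y ∘ suc))

dot-zeroˡ : (x : Pt n) → dot (λ _ → 0ℚ) x ≡ 0ℚ
dot-zeroˡ {zero} x = refl
dot-zeroˡ {suc n} x = trans (cong₂ _+_ (*-zeroˡ (x zero)) (dot-zeroˡ (x ∘ suc))) (+-identityʳ 0ℚ)

dot-zeroʳ : (a : Pt n) → dot a (λ _ → 0ℚ) ≡ 0ℚ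
dot-zeroʳ {zero} a = refl
dot-zeroʳ {suc n} a = trans (cong₂ _+_ (*-zeroʳ (a zero)) (dot-zeroʳ (a ∘ suc))) (+-identityʳ 0ℚ)

dot-+ʳ : (a x y : Pt n) → dot a (λ k → x k + y k) ≡ dot a x + dot a y
dot-+ʳ {zero} a x y = refl
dot-+ʳ {suc n} a x y =
  trans (cong (a zero * (x zero + y zero) +_) (dot-+ʳ (a ∘ suc) (x ∘ suc) (y ∘ suc)))
        (solve 5 (λ a x y s t → a :* (x :+ y) :+ (s :+ t) := (a :* x :+ s) :+ (a :* y :+ t))
               refl (a zero) (x zero) (y zero) (dot (a ∘ suc) (x ∘ suc)) (dot (a ∘ suc) (y ∘ suc)))

dot-*ʳ : (a : Pt n) (c : ℚ) (x : Pt n) → dot a (λ k → c * x k) ≡ c * dot a x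
dot-*ʳ {zero} a c x = sym (*-zeroʳ c)
dot-*ʳ {suc n} a c x =
  trans (cong (a zero * (c * x zero) +_) (dot-*ʳ (a ∘ suc) c (x ∘ suc)))
        (solve 4 (λ a c x s → a :* (c :* x) :+ c :* s := c :* (a :* x :+ s))
               refl (a zero) c (x zero) (dot (a ∘ suc) (x ∘ suc)))

unitVec-suc : (i k : Fin n) → unitVec (suc i) (suc k) ≡ unitVec i k
unitVec-suc i k with k ≟ i
... | yes _ = refl
... | no _ = refl

dot-unitVec : (a : Pt n) (i : Fin n) → dot a (unitVec i) ≡ a i
dot-unitVec {suc n} a zero =
  trans (cong₂ _+_ (*-identityʳ (a zero)) (dot-zeroʳ (a ∘ suc))) (+-identityʳ (a zero))
dot-unitVec {suc n} a (suc i) =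
  trans (cong₂ _+_ (*-zeroʳ (a zero)) (trans (dot-congʳ (a ∘ suc) (unitVec-suc i)) (dot-unitVec (a ∘ suc) i)))
        (+-identityˡ (a (suc i)))

dot-edgeVec : (a : Pt n) (e : Edge n) → dot a (edgeVec e) ≡ a (proj₁ e) + a (proj₂ e)
dot-edgeVec a (i , j) =
  trans (dot-+ʳ a (unitVec i) (unitVec j)) (cong₂ _+_ (dot-unitVec a i) (dot-unitVec a j))

weighted : {A : Set} → (A → ℚ) → List ℚ → List A → ℚ
weighted f w vs = sumℚ (zipWith (λ c v → c * f v) w vs)

dot-weighted : (a : Pt n) (w : List ℚ) (vs : List (Pt n)) →
  dot a (λ k → weighted (λ v → v k) w vs) ≡ weighted (dot a) w vs
dot-weighted a [] vs = dot-zeroʳ a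
dot-weighted a (c ∷ w) [] = dot-zeroʳ a
dot-weighted a (c ∷ w) (v ∷ vs) =
  trans (dot-+ʳ a (λ k → c * v k) (λ k → weighted (λ u → u k) w vs))
        (cong₂ _+_ (dot-*ʳ a c v) (dot-weighted a w vs))

weighted-mono : {A : Set} {f g : A → ℚ} {w : List ℚ} {vs : List A} →
  All (0ℚ ≤_) w → All (λ v → f v ≤ g v) vs → weighted f w vs ≤ weighted g w vs
weighted-mono [] _ = ≤-refl
weighted-mono (_ ∷ _) [] = ≤-refl
weighted-mono {w = c ∷ _} (0≤c ∷ 0≤w) (fv≤gv ∷ f≤g) =
  +-mono-≤ (*-monoˡ-≤-nonNeg c {{nonNegative 0≤c}} fv≤gv) (weighted-mono 0≤w f≤g)

weighted-tight : {A : Set} {f g : A → ℚ} {w : List ℚ} {vs : List A} → length w ≡ length vs →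
  All (0ℚ ≤_) w → All (λ v → f v ≤ g v) vs → weighted f w vs ≡ weighted g w vs →
  Pointwise (λ c v → c ≡ 0ℚ ⊎ f v ≡ g v) w vs
weighted-tight {w = []} {[]} _ _ _ _ = []
weighted-tight {w = c ∷ w} {v ∷ vs} len (0≤c ∷ 0≤w) (fv≤gv ∷ f≤g) eq
  with +-≤-tight (*-monoˡ-≤-nonNeg c {{nonNegative 0≤c}} fv≤gv) (weighted-mono 0≤w f≤g) eq
... | head-eq , rest-eq = *-≤-tight 0≤c fv≤gv head-eq ∷ weighted-tight (suc-injective len) 0≤w f≤g rest-eq

weighted-const : {A : Set} (b : ℚ) {w : List ℚ} {vs : List A} → length w ≡ length vs →
  sumℚ w ≡ 1ℚ → weighted (λ _ → b) w vs ≡ b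
weighted-const b {w} {vs} len sum≡1 = trans (scaled w vs len) (trans (cong (_* b) sum≡1) (*-identityˡ b))
  where
  scaled : ∀ w vs → length w ≡ length vs → weighted (λ _ → b) w vs ≡ sumℚ w * b
  scaled [] [] _ = sym (*-zeroˡ b)
  scaled (c ∷ w) (v ∷ vs) len =
    trans (cong (c * b +_) (scaled w vs (suc-injective len)))
          (solve 3 (λ c s b → c :* b :+ s :* b := (c :+ s) :* b) refl c (sumℚ w) b)

-- InConv vs is definitionally InScaledConv vs 1ℚ.
InScaledConv : List (Pt n) → ℚ → Pt n → Set
InScaledConv vs t x =
  Σ (List ℚ) λ w →
    (length w ≡ length vs) × All (0ℚ ≤_) w × (sumℚ w ≡ t) × (∀ k → x k ≡ weighted (λ v → v k) w vs)

InScaledConv-cong : {vs : List (Pt n)} {t t′ : ℚ} {x x′ : Pt n} →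
  t ≡ t′ → (∀ k → x k ≡ x′ k) → InScaledConv vs t x → InScaledConv vs t′ x′
InScaledConv-cong t≡t′ x≗x′ (w , len , 0≤w , sum≡t , x≗) =
  w , len , 0≤w , trans sum≡t t≡t′ , λ k → trans (sym (x≗x′ k)) (x≗ k)

InScaledConv-zero : (vs : List (Pt n)) → InScaledConv vs 0ℚ (λ _ → 0ℚ)
InScaledConv-zero [] = [] , refl , [] , refl , λ _ → refl
InScaledConv-zero (v ∷ vs) with InScaledConv-zero vs
... | w , len , 0≤w , sum≡0 , 0≗ =
  0ℚ ∷ w , cong suc len , ≤-refl ∷ 0≤w , trans (+-identityˡ (sumℚ w)) sum≡0 ,
  λ k → trans (0≗ k) (sym (trans (cong (_+ _) (*-zeroˡ (v k))) (+-identityˡ _)))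

InScaledConv-add : {vs : List (Pt n)} {v : Pt n} {c t : ℚ} {y : Pt n} → v ∈ vs → 0ℚ ≤ c →
  InScaledConv vs t y → InScaledConv vs (c + t) (λ k → c * v k + y k)
InScaledConv-add {v = v} {c} (here refl) 0≤c (d ∷ w , len , 0≤d ∷ 0≤w , sum≡t , y≗) =
  c + d ∷ w , len , +-mono-≤ 0≤c 0≤d ∷ 0≤w ,
  trans (solve 3 (λ c d s → (c :+ d) :+ s := c :+ (d :+ s)) refl c d (sumℚ w)) (cong (c +_) sum≡t) ,
  λ k → trans (cong (c * v k +_) (y≗ k))
              (solve 4 (λ c d x r → c :* x :+ (d :* x :+ r) := (c :+ d) :* x :+ r)
                     refl c d (v k) (weighted (λ u → u k) w _))
InScaledConv-add {vs = u ∷ vs} {v} {c} (Any.there v∈vs) 0≤c (d ∷ w , len , 0≤d ∷ 0≤w , sum≡t , y≗)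
  with InScaledConv-add v∈vs 0≤c (w , suc-injective len , 0≤w , refl , λ _ → refl)
... | w′ , len′ , 0≤w′ , sum′ , y′≗ =
  d ∷ w′ , cong suc len′ , 0≤d ∷ 0≤w′ ,
  trans (cong (d +_) sum′)
        (trans (solve 3 (λ d c s → d :+ (c :+ s) := c :+ (d :+ s)) refl d c (sumℚ w)) (cong (c +_) sum≡t)) ,
  λ k → trans (cong (c * v k +_) (y≗ k))
              (trans (solve 3 (λ x y r → x :+ (y :+ r) := y :+ (x :+ r)) refl (c * v k) (d * u k) _)
                     (cong (d * u k +_) (y′≗ k)))

rebase : {vs ws : List (Pt n)} {w : List ℚ} → All (0ℚ ≤_) w →
  Pointwise (λ c v → c ≡ 0ℚ ⊎ v ∈ ws) w vs → InScaledConv ws (sumℚ w) (λ k → weighted (λ v → v k) w vs)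
rebase {ws = ws} [] [] = InScaledConv-zero ws
rebase {vs = v ∷ vs} {w = _ ∷ w} (_ ∷ 0≤w) (inj₁ refl ∷ supp) =
  InScaledConv-cong (sym (+-identityˡ (sumℚ w)))
    (λ k → sym (trans (cong (_+ _) (*-zeroˡ (v k))) (+-identityˡ _)))
    (rebase 0≤w supp)
rebase (0≤c ∷ 0≤w) (inj₂ v∈ws ∷ supp) = InScaledConv-add v∈ws 0≤c (rebase 0≤w supp)

dot-InConv : (a : Pt n) {vs : List (Pt n)} {x : Pt n} → ((w , _) : InConv vs x) → dot a x ≡ weighted (dot a) w vs
dot-InConv a {vs} (w , _ , _ , _ , x≗) = trans (dot-congʳ a x≗) (dot-weighted a w vs)

InConv-≤ : {vs : List (Pt n)} (a : Pt n) {b : ℚ} {x : Pt n} →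
  (∀ {v} → v ∈ vs → dot a v ≤ b) → InConv vs x → dot a x ≤ b
InConv-≤ {vs = vs} a {b} {x} valid px@(w , len , 0≤w , sum≡1 , _) = begin
  dot a x                   ≡⟨ dot-InConv a px ⟩
  weighted (dot a) w vs     ≤⟨ weighted-mono 0≤w (All.tabulate valid) ⟩
  weighted (λ _ → b) w vs   ≡⟨ weighted-const b {w} {vs} len sum≡1 ⟩
  b                         ∎
  where open ≤-Reasoning

InConv-dot-agree : {vs : List (Pt n)} (a a′ : Pt n) {x : Pt n} →
  (∀ {v} → v ∈ vs → dot a v ≡ dot a′ v) → InConv vs x → dot a x ≡ dot a′ x
InConv-dot-agree a a′ agree px@(w , _ , 0≤w , _ , _) =
  trans (dot-InConv a px)
        (trans (≤-antisym (weighted-mono 0≤w (All.tabulate (≤-reflexive ∘ agree)))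
                          (weighted-mono 0≤w (All.tabulate (≤-reflexive ∘ sym ∘ agree))))
               (sym (dot-InConv a′ px)))

InConv-tight : {vs ws : List (Pt n)} (a : Pt n) {b : ℚ} {x : Pt n} →
  (∀ {v} → v ∈ vs → dot a v ≤ b) → (∀ {v} → v ∈ vs → dot a v ≡ b → v ∈ ws) →
  InConv vs x → dot a x ≡ b → InConv ws x
InConv-tight {vs = vs} {ws} a {b} {x} valid tight px@(w , len , 0≤w , sum≡1 , x≗) ax≡b =
  InScaledConv-cong sum≡1 (λ k → sym (x≗ k))
    (rebase 0≤w (supported (weighted-tight len 0≤w (All.tabulate valid) tight-sum) (All.tabulate tight)))
  where
  tight-sum : weighted (dot a) w vs ≡ weighted (λ _ → b) w vs
  tight-sum = trans (sym (dot-InConv a px)) (trans ax≡b (sym (weighted-const b {w} {vs} len sum≡1)))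

  supported : ∀ {w′ us} → Pointwise (λ c v → c ≡ 0ℚ ⊎ dot a v ≡ b) w′ us →
    All (λ v → dot a v ≡ b → v ∈ ws) us → Pointwise (λ c v → c ≡ 0ℚ ⊎ v ∈ ws) w′ us
  supported [] [] = []
  supported (inj₁ c≡0 ∷ rest) (_ ∷ tights) = inj₁ c≡0 ∷ supported rest tights
  supported (inj₂ av≡b ∷ rest) (tightᵥ ∷ tights) = inj₂ (tightᵥ av≡b) ∷ supported rest tights

-- conv ws is the face of conv vs cut out by the zero functional at level 0.
InConv-mono : {vs ws : List (Pt n)} {x : Pt n} → ws ⊆ vs → InConv ws x → InConv vs x
InConv-mono {x = x} ws⊆vs px =
  InConv-tight (λ _ → 0ℚ) (λ {v} _ → ≤-reflexive (dot-zeroˡ v)) (λ v∈ws _ → ws⊆vs v∈ws) px (dot-zeroˡ x)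

∈⇒InConv : {vs : List (Pt n)} {v : Pt n} → v ∈ vs → InConv vs v
∈⇒InConv {v = v} v∈vs =
  InConv-mono {ws = v ∷ []} (λ { (here refl) → v∈vs ; (Any.there ()) })
    (1ℚ ∷ [] , refl , nonNegative⁻¹ 1ℚ ∷ [] , +-identityʳ 1ℚ ,
     λ k → sym (trans (+-identityʳ _) (*-identityˡ (v k))))

IsFace-restrict : {F Q P : Pt n → Set} → (∀ {x} → F x → Q x) → (∀ {x} → Q x → P x) →
  IsFace F P → IsFace F Q
IsFace-restrict F⊆Q Q⊆P (a , b , valid , face) =
  a , b , (λ x qx → valid x (Q⊆P qx)) ,
  λ x → mk⇔ (λ fx → F⊆Q fx , proj₂ (to (face x) fx))
            (λ (qx , ax≡b) → from (face x) (Q⊆P qx , ax≡b))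

IsFace-lift : {F : Pt n → Set} {vs ws : List (Pt n)} → ws ⊆ vs →
  (∀ (a : Pt n) (b : ℚ) → Σ (Pt n) λ a′ →
     (∀ {v} → v ∈ ws → dot a′ v ≡ dot a v) × (∀ {v} → v ∈ vs → v ∈ ws ⊎ dot a′ v < b)) →
  IsFace F (InConv ws) → IsFace F (InConv vs)
IsFace-lift {F = F} {vs} {ws} ws⊆vs separate (a , b , valid , face)
  with separate a b
... | a′ , agree , split = a′ , b , (λ _ → InConv-≤ a′ vertex-valid) , λ x → mk⇔ into outof
  where
  vertex-valid : ∀ {v} → v ∈ vs → dot a′ v ≤ b
  vertex-valid v∈vs with split v∈vs
  ... | inj₁ v∈ws = ≤-trans (≤-reflexive (agree v∈ws)) (valid _ (∈⇒InConv v∈ws))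
  ... | inj₂ a′v<b = <⇒≤ a′v<b

  vertex-tight : ∀ {v} → v ∈ vs → dot a′ v ≡ b → v ∈ ws
  vertex-tight v∈vs a′v≡b with split v∈vs
  ... | inj₁ v∈ws = v∈ws
  ... | inj₂ a′v<b = ⊥-elim (<⇒≢ a′v<b a′v≡b)

  agree-InConv : ∀ {x} → InConv ws x → dot a′ x ≡ dot a x
  agree-InConv = InConv-dot-agree a′ a agree

  into : ∀ {x} → F x → InConv vs x × dot a′ x ≡ b
  into {x} fx with to (face x) fx
  ... | qx , ax≡b = InConv-mono ws⊆vs qx , trans (agree-InConv qx) ax≡b

  outof : ∀ {x} → InConv vs x × dot a′ x ≡ b → F x
  outof {x} (px , a′x≡b) = from (face x) (qx , trans (sym (agree-InConv qx)) a′x≡b)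
    where
    qx : InConv ws x
    qx = InConv-tight a′ vertex-valid vertex-tight px a′x≡b

lower-outside : {S : Fin n → Set} → (∀ v → Dec (S v)) → (a : Pt n) (b : ℚ) →
  Σ (Pt n) λ a′ → (∀ v → S v → a′ v ≡ a v) × (∀ i j → ¬ S i → a′ i + a′ j < b)
lower-outside {n} {S} S? a b = a′ , inside , one-outside
  where
  T : ℚ
  T = proj₁ (upperBound a)

  -- o ≤ T and o + T < b, so a pair with an endpoint lowered to o stays below b.
  o : ℚ
  o = (b - 1ℚ - T) ⊓ T

  a′ : Pt n
  a′ v with S? v
  ... | yes _ = a v
  ... | no _ = o

  inside : ∀ v → S v → a′ v ≡ a v
  inside v sv with S? v
  ... | yes _ = refl
  ... | no ¬sv = ⊥-elim (¬sv sv)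

  outside : ∀ v → ¬ S v → a′ v ≡ o
  outside v ¬sv with S? v
  ... | yes sv = ⊥-elim (¬sv sv)
  ... | no _ = refl

  a′≤T : ∀ v → a′ v ≤ T
  a′≤T v with S? v
  ... | yes _ = proj₂ (upperBound a) v
  ... | no _ = p⊓q≤q (b - 1ℚ - T) T

  one-outside : ∀ i j → ¬ S i → a′ i + a′ j < b
  one-outside i j ¬si = begin-strict
    a′ i + a′ j       ≡⟨ cong (_+ a′ j) (outside i ¬si) ⟩
    o + a′ j          ≤⟨ +-monoʳ-≤ o (a′≤T j) ⟩
    o + T             ≤⟨ +-monoˡ-≤ T (p⊓q≤p (b - 1ℚ - T) T) ⟩
    b - 1ℚ - T + T    ≡⟨ solve 2 (λ b T → b :- con 1ℚ :- T :+ T := b :+ :- con 1ℚ) refl b T ⟩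
    b + - 1ℚ          <⟨ +-monoʳ-< b (negative⁻¹ (- 1ℚ)) ⟩
    b + 0ℚ            ≡⟨ +-identityʳ b ⟩
    b                 ∎
    where open ≤-Reasoning

Inside : Graph n → Edge n → Set
Inside H e = InV H (proj₁ e) × InV H (proj₂ e)

inside? : (H : Graph n) (e : Edge n) → Dec (Inside H e)
inside? H e = inV? H (proj₁ e) ×-dec inV? H (proj₂ e)

edge⇒Inside : (H : Graph n) {e : Edge n} → e ∈ edges H → Inside H e
edge⇒Inside H e∈H = Any.map (inj₁ ∘ cong proj₁) e∈H , Any.map (inj₂ ∘ cong proj₂) e∈H

induced⊆edges : (G H : Graph n) → inducedEdges G H ⊆ edges G
induced⊆edges G H = filter-⊆ (inside? H) (edges G)

subgraph⊆induced : (G H : Graph n) → Subgraph H G → edges H ⊆ inducedEdges G H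
subgraph⊆induced G H sub e∈H = ∈-filter⁺ (inside? H) (sub _ e∈H) (edge⇒Inside H e∈H)

induced-separation : (G H : Graph n) {a a′ : Pt n} {b : ℚ} →
  (∀ v → InV H v → a′ v ≡ a v) → (∀ i j → ¬ InV H i → a′ i + a′ j < b) →
  (∀ {v} → v ∈ map edgeVec (inducedEdges G H) → dot a′ v ≡ dot a v) ×
  (∀ {v} → v ∈ map edgeVec (edges G) → v ∈ map edgeVec (inducedEdges G H) ⊎ dot a′ v < b)
induced-separation G H {a} {a′} {b} inside one-outside = agree , split
  where
  agree : ∀ {v} → v ∈ map edgeVec (inducedEdges G H) → dot a′ v ≡ dot a v
  agree v∈ with ∈-map∘filter⁻ edgeVec (inside? H) {xs = edges G} v∈
  ... | (i , j) , _ , refl , si , sj =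
    trans (dot-edgeVec a′ (i , j)) (trans (cong₂ _+_ (inside i si) (inside j sj)) (sym (dot-edgeVec a (i , j))))

  split : ∀ {v} → v ∈ map edgeVec (edges G) → v ∈ map edgeVec (inducedEdges G H) ⊎ dot a′ v < b
  split v∈ with ∈-map⁻ edgeVec v∈
  ... | (i , j) , e∈G , refl with inV? H i | inV? H j
  ... | yes si | yes sj = inj₁ (∈-map∘filter⁺ edgeVec (inside? H) {xs = edges G} ((i , j) , e∈G , refl , si , sj))
  ... | no ¬si | _ = inj₂ (<-respˡ-≡ (sym (dot-edgeVec a′ (i , j))) (one-outside i j ¬si))
  ... | yes _ | no ¬sj =
    inj₂ (<-respˡ-≡ (trans (+-comm (a′ j) (a′ i)) (sym (dot-edgeVec a′ (i , j)))) (one-outside j i ¬sj))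

lemma2p7 : (n : ℕ) (G H : Graph n) → NoIsolated G → Subgraph H G →
    IsFace (EdgePolytope H) (EdgePolytope G) ⇔ IsFace (EdgePolytope H) (InducedEdgePolytope G H)
lemma2p7 n G H _ sub = mk⇔
  (IsFace-restrict (InConv-mono (map⁺ edgeVec (subgraph⊆induced G H sub))) (InConv-mono induced⊆G))
  (IsFace-lift induced⊆G λ a b →
    let a′ , inside , one-outside = lower-outside (inV? H) a b
    in a′ , induced-separation G H inside one-outside)
  where
  induced⊆G : map edgeVec (inducedEdges G H) ⊆ map edgeVec (edges G)
  induced⊆G = map⁺ edgeVec (induced⊆edges G H)
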